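{- Let $\ell\in\mathbb{N}\cup\{0\}$ and let $R_\ell(m,N)$ be the number of generalized Rogers--Ramanujan partitions of $N$ (associated with $\ell$) with rank $m$. Then, as formal power series, \[ \sum_{N=0}^{\infty}\sum_{m=-\infty}^{\infty}R_\ell(m,N)z^mq^N=\sum_{n=0}^{\infty}\frac{z^{n+\ell-1}q^{n^2+\ell n}}{(zq;q)_n}. \]
   Context: A generalized Rogers--Ramanujan partition of $N$ associated with $\ell$ is a partition of $N$ into parts all greater than $\ell$ in which any two parts differ by at least $2$. The rank of a partition is its largest part minus its number of parts; the identity corresponds to the convention that the empty partition contributes $z^{\ell-1}$ (i.e. is assigned rank $\ell-1$). Notation: $(a;q)_0=1$, $(a;q)_n=\prod_{k=0}^{n-1}(1-aq^k)$. -}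

module Defs where

open import Data.Nat as ℕ using (ℕ; zero; suc; _+_; _*_; _∸_; _≤_; _<_; _≤?_; _<?_; _⊔_)
open import Data.Integer as ℤ using (ℤ; +_; -[1+_])
import Data.Integer.Properties as ℤP
open import Data.Bool using (Bool; true; false)
open import Data.Vec using (Vec; []; _∷_)
open import Data.List as L using (List; []; _∷_; _++_; map; length; filter; foldr)
open import Data.Nat.ListAction using (sum)
open import Data.List.Relation.Unary.All using (All; all?)
open import Data.Product using (_×_; _,_)
open import Relation.Nullary using (Dec; yes; no)
open import Relation.Nullary.Decidable using (_×-dec_)
open import Relation.Binary.PropositionalEquality using (_≡_)

-- Partitions into distinct parts of size ≤ n, encoded as subsets of
-- {1,…,n}: v : Vec Bool n, position i (0-based) true ⇔ i+1 is a part.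

allVecs : (n : ℕ) → List (Vec Bool n)
allVecs zero    = [] ∷ []
allVecs (suc n) = map (true ∷_) (allVecs n) ++ map (false ∷_) (allVecs n)

parts : ∀ {n} → Vec Bool n → List ℕ
parts []          = []
parts (true  ∷ v) = 1 ∷ map suc (parts v)
parts (false ∷ v) = map suc (parts v)

Gap2 : List ℕ → Set
Gap2 []           = Data.Unit.⊤ where import Data.Unit
Gap2 (x ∷ [])     = Data.Unit.⊤ where import Data.Unit
Gap2 (x ∷ y ∷ xs) = (x + 2 ≤ y) × Gap2 (y ∷ xs)

gap2? : (xs : List ℕ) → Dec (Gap2 xs)
gap2? []           = yes _
gap2? (x ∷ [])     = yes _
gap2? (x ∷ y ∷ xs) = (x + 2 ≤? y) ×-dec gap2? (y ∷ xs)

IsRR : (ℓ N : ℕ) → Vec Bool N → Set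
IsRR ℓ N v = (sum (parts v) ≡ N) × All (ℓ <_) (parts v) × Gap2 (parts v)

isRR? : (ℓ N : ℕ) → (v : Vec Bool N) → Dec (IsRR ℓ N v)
isRR? ℓ N v = (sum (parts v) ℕ.≟ N) ×-dec (all? (ℓ <?_) (parts v) ×-dec gap2? (parts v))

rank : (ℓ : ℕ) → List ℕ → ℤ
rank ℓ []         = + ℓ ℤ.- + 1
rank ℓ ps@(_ ∷ _) = + (foldr _⊔_ 0 ps) ℤ.- + (length ps)

R : (ℓ : ℕ) → ℤ → ℕ → ℕ
R ℓ m N = length (filter (λ v → isRR? ℓ N v ×-dec (rank ℓ (parts v) ℤ.≟ m)) (allVecs N))

-- Formal power series in ℤ[[z,q]]: f a b = coefficient of z^a q^b.

PS : Set
PS = ℕ → ℕ → ℤ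

sumTo : ℕ → (ℕ → ℤ) → ℤ
sumTo zero    f = f 0
sumTo (suc n) f = sumTo n f ℤ.+ f (suc n)

_*ₚ_ : PS → PS → PS
(f *ₚ g) a b = sumTo a (λ i → sumTo b (λ j → f i j ℤ.* g (a ∸ i) (b ∸ j)))

oneₚ : PS
oneₚ zero zero = + 1
oneₚ _    _    = + 0

_≈ₚ_ : PS → PS → Set
f ≈ₚ g = ∀ a b → f a b ≡ g a b

-- 1 - z q^k
oneMinusZQ^ : ℕ → PS
oneMinusZQ^ k zero    zero = + 1
oneMinusZQ^ k (suc zero) b with b ℕ.≟ k
... | yes _ = ℤ.- (+ 1)
... | no  _ = + 0
oneMinusZQ^ k _ _ = + 0

-- (zq;q)_n = ∏_{k=0}^{n-1} (1 - z q^{k+1})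
poch : ℕ → PS
poch zero    = oneₚ
poch (suc n) = poch n *ₚ oneMinusZQ^ (suc n)

-- Right-hand side coefficient of z^m q^N (m ∈ ℤ) in
--   Σ_{n≥0} z^{n+ℓ-1} q^{n²+ℓn} · I n,   where I n = 1/(zq;q)_n.
-- Term n is z^{n+ℓ-1}q^{n²+ℓn}·(I n); only n ≤ N contribute to q^N
-- since n²+ℓn ≥ n (for n ≥ 1; n = 0 is included anyway).

shiftCoeff : PS → ℤ → ℕ → ℤ → ℕ → ℤ
shiftCoeff f e d m N with d ≤? N | m ℤ.- e
... | yes _ | + k      = f k (N ∸ d)
... | yes _ | -[1+ _ ] = + 0
... | no  _ | _        = + 0

rhsCoeff : (ℓ : ℕ) → (ℕ → PS) → ℤ → ℕ → ℤ
rhsCoeff ℓ I m N =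
  sumTo N (λ n → shiftCoeff (I n) (+ (n + ℓ) ℤ.- + 1) (n * n + ℓ * n) m N)

{-# OPTIONS --safe #-}
-- Encode a partition counted by R_ℓ(m,N) by its set of parts inside {1,…,N} and sort by the
-- number n of parts. Subtracting 1 from every part maps these partitions bijectively onto the
-- partitions of N − n for ℓ ∸ 1 with n parts and rank m − 1, except that for ℓ = 0 the part 1 may
-- occur; deleting it as well leaves a partition of N − n for ℓ = 1 with n − 1 parts and rank m.
-- The coefficient of z^m q^N in z^(n+ℓ−1) q^(n²+ℓn) / (zq;q)_n obeys the same recursions, because
-- 1/(zq;q)_(n+1) = 1/(zq;q)_n + z q^(n+1)/(zq;q)_(n+1). The given I n equals 1/(zq;q)_n, since
-- (zq;q)_n has constant term 1 and such a series has a unique inverse.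
module Submission where

open import Defs
open import Data.Nat as ℕ using (ℕ; zero; suc; _∸_; z≤n; s≤s; _≤?_; _<?_; _⊔_)
open import Data.Nat.Properties as ℕP using (≤-refl; m≤n⇒m≤1+n; <⇒≢)
open import Data.Nat.Induction using (<-rec)
open import Data.Nat.ListAction using (sum)
import Data.Nat.Tactic.RingSolver as ℕSolver
open import Data.Integer as ℤ using (ℤ; +_; -[1+_]; _+_; _*_; -_; _-_)
open import Data.Integer.Properties as ℤP
  using (+-identityʳ; +-identityˡ; *-identityʳ; *-zeroʳ; +-comm; +-assoc)
open import Data.Integer.Tactic.RingSolver using (solve-∀)
open import Algebra.Properties.CommutativeSemigroup ℤP.+-commutativeSemigroup using (interchange)
import Algebra.Properties.CommutativeSemigroup ℕP.+-commutativeSemigroup as ℕCS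
open import Algebra.Properties.AbelianGroup ℤP.+-0-abelianGroup using (∙-cancelˡ)
open import Data.Bool using (Bool; true; false; if_then_else_)
open import Data.Vec using (Vec; []; _∷_)
open import Data.List using (List; []; _∷_; _++_; map; length; filter; foldr)
import Data.List.Properties as LP
open import Data.List.Relation.Unary.All as All using (All; all?; []; _∷_)
import Data.List.Relation.Unary.All.Properties as AllP
open import Data.Product using (_×_; _,_; proj₁; proj₂)
open import Data.Sum using (inj₁; inj₂)
open import Data.Empty using (⊥-elim)
open import Function using (_∘_; _⇔_; mk⇔; Equivalence)
open import Relation.Nullary using (Dec; yes; no; ¬_; does)
open import Relation.Nullary.Decidable using (_×-dec_)
open import Relation.Unary using (Decidable)
open import Relation.Binary.PropositionalEquality
open ≡-Reasoning

-- Finite sums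

sumTo-cong : ∀ a {F G : ℕ → ℤ} → (∀ i → i ℕ.≤ a → F i ≡ G i) → sumTo a F ≡ sumTo a G
sumTo-cong zero    F≡G = F≡G 0 z≤n
sumTo-cong (suc a) F≡G =
  cong₂ _+_ (sumTo-cong a (λ i i≤a → F≡G i (m≤n⇒m≤1+n i≤a))) (F≡G (suc a) ≤-refl)

sumTo-zero : ∀ a {F : ℕ → ℤ} → (∀ i → i ℕ.≤ a → F i ≡ + 0) → sumTo a F ≡ + 0
sumTo-zero a F≡0 = trans (sumTo-cong a F≡0) (zeros a)
  where
  zeros : ∀ a → sumTo a (λ _ → + 0) ≡ + 0
  zeros zero    = refl
  zeros (suc a) = cong (_+ + 0) (zeros a)

sumTo-single : ∀ a c {F : ℕ → ℤ} → c ℕ.≤ a → (∀ i → i ℕ.≤ a → i ≢ c → F i ≡ + 0) →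
               sumTo a F ≡ F c
sumTo-single zero    zero    _     _   = refl
sumTo-single (suc a) c {F} c≤1+a F≡0 with ℕP.m≤n⇒m<n∨m≡n c≤1+a
... | inj₂ refl = begin
  sumTo a F + F (suc a) ≡⟨ cong (_+ F (suc a)) (sumTo-zero a (λ i i≤a →
                             F≡0 i (m≤n⇒m≤1+n i≤a) (<⇒≢ (s≤s i≤a)))) ⟩
  + 0 + F (suc a)       ≡⟨ +-identityˡ _ ⟩
  F (suc a)             ∎
... | inj₁ (s≤s c≤a) = begin
  sumTo a F + F (suc a) ≡⟨ cong₂ _+_ (sumTo-single a c c≤a (λ i i≤a → F≡0 i (m≤n⇒m≤1+n i≤a)))
                                     (F≡0 (suc a) ≤-refl (λ 1+a≡c → <⇒≢ (s≤s c≤a) (sym 1+a≡c))) ⟩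
  F c + + 0             ≡⟨ +-identityʳ _ ⟩
  F c                   ∎

sumTo-suc : ∀ a (F : ℕ → ℤ) → sumTo (suc a) F ≡ F 0 + sumTo a (λ i → F (suc i))
sumTo-suc zero    F = refl
sumTo-suc (suc a) F = trans (cong (_+ F (suc (suc a))) (sumTo-suc a F)) (+-assoc (F 0) _ _)

sumTo-reverse : ∀ a (F : ℕ → ℤ) → sumTo a F ≡ sumTo a (λ i → F (a ∸ i))
sumTo-reverse zero    F = refl
sumTo-reverse (suc a) F = begin
  sumTo a F + F (suc a)                    ≡⟨ cong (_+ F (suc a)) (sumTo-reverse a F) ⟩
  sumTo a (λ i → F (a ∸ i)) + F (suc a)    ≡⟨ +-comm _ (F (suc a)) ⟩
  F (suc a) + sumTo a (λ i → F (a ∸ i))    ≡⟨ sumTo-suc a (λ i → F (suc a ∸ i)) ⟨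
  sumTo (suc a) (λ i → F (suc a ∸ i))      ∎

sumTo-+ : ∀ a (F G : ℕ → ℤ) → sumTo a (λ i → F i + G i) ≡ sumTo a F + sumTo a G
sumTo-+ zero    F G = refl
sumTo-+ (suc a) F G =
  trans (cong (_+ (F (suc a) + G (suc a))) (sumTo-+ a F G))
        (interchange (sumTo a F) (sumTo a G) (F (suc a)) (G (suc a)))

sumTo-neg : ∀ a (F : ℕ → ℤ) → sumTo a (λ i → - F i) ≡ - sumTo a F
sumTo-neg zero    F = refl
sumTo-neg (suc a) F =
  trans (cong (_+ - F (suc a)) (sumTo-neg a F)) (sym (ℤP.neg-distrib-+ (sumTo a F) (F (suc a))))

sumTo-- : ∀ a (F G : ℕ → ℤ) → sumTo a (λ i → F i - G i) ≡ sumTo a F - sumTo a G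
sumTo-- a F G = trans (sumTo-+ a F (λ i → - G i)) (cong (λ x → sumTo a F + x) (sumTo-neg a G))

sumTo-tail : ∀ c e (F : ℕ → ℤ) → (∀ j → c ℕ.< j → j ℕ.≤ e ℕ.+ c → F j ≡ + 0) →
             sumTo (e ℕ.+ c) F ≡ sumTo c F
sumTo-tail c zero    F _   = refl
sumTo-tail c (suc e) F F≡0 = begin
  sumTo (e ℕ.+ c) F + F (suc (e ℕ.+ c))
    ≡⟨ cong₂ _+_ (sumTo-tail c e F (λ j c<j j≤ → F≡0 j c<j (m≤n⇒m≤1+n j≤)))
                 (F≡0 _ (s≤s (ℕP.m≤n+m c e)) ≤-refl) ⟩
  sumTo c F + + 0
    ≡⟨ +-identityʳ _ ⟩
  sumTo c F ∎

sumBelow : ℕ → (ℕ → ℤ) → ℤ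
sumBelow zero    F = + 0
sumBelow (suc a) F = sumTo a F

sumTo≡sumBelow+last : ∀ a (F : ℕ → ℤ) → sumTo a F ≡ sumBelow a F + F a
sumTo≡sumBelow+last zero    F = sym (+-identityˡ (F 0))
sumTo≡sumBelow+last (suc a) F = refl

sumBelow-cong : ∀ a {F G : ℕ → ℤ} → (∀ i → i ℕ.< a → F i ≡ G i) → sumBelow a F ≡ sumBelow a G
sumBelow-cong zero    F≡G = refl
sumBelow-cong (suc a) F≡G = sumTo-cong a (λ i i≤a → F≡G i (s≤s i≤a))

-- Power series in q, and in z and q

conv : (ℕ → ℤ) → (ℕ → ℤ) → ℕ → ℤ
conv F u b = sumTo b (λ j → F j * u (b ∸ j))

shiftQ : ℕ → (ℕ → ℤ) → ℕ → ℤ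
shiftQ d u M with d ≤? M
... | yes _ = u (M ∸ d)
... | no  _ = + 0

shiftQ-above : ∀ {d M} u → d ℕ.≤ M → shiftQ d u M ≡ u (M ∸ d)
shiftQ-above {d} {M} u d≤M with d ≤? M
... | yes _   = refl
... | no  d≰M = ⊥-elim (d≰M d≤M)

shiftQ-below : ∀ {d M} u → ¬ d ℕ.≤ M → shiftQ d u M ≡ + 0
shiftQ-below {d} {M} u d≰M with d ≤? M
... | yes d≤M = ⊥-elim (d≰M d≤M)
... | no  _   = refl

shiftQ-at : ∀ d u r → shiftQ d u (d ℕ.+ r) ≡ u r
shiftQ-at d u r = trans (shiftQ-above u (ℕP.m≤m+n d r)) (cong u (ℕP.m+n∸m≡n d r))

shiftQ-offset : ∀ n d u M → shiftQ (n ℕ.+ d) u (n ℕ.+ M) ≡ shiftQ d u M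
shiftQ-offset n d u M with d ≤? M
... | yes d≤M = trans (shiftQ-above u (ℕP.+-monoʳ-≤ n d≤M)) (cong u (ℕP.[m+n]∸[m+o]≡n∸o n M d))
... | no  d≰M = shiftQ-below u (λ n+d≤n+M → d≰M (ℕP.+-cancelˡ-≤ n d M n+d≤n+M))

shiftQ-cong : ∀ d {u v} → (∀ r → u r ≡ v r) → ∀ M → shiftQ d u M ≡ shiftQ d v M
shiftQ-cong d u≡v M with d ≤? M
... | yes _ = u≡v (M ∸ d)
... | no  _ = refl

shiftQ-zero : ∀ d M → shiftQ d (λ _ → + 0) M ≡ + 0
shiftQ-zero d M with d ≤? M
... | yes _ = refl
... | no  _ = refl

shiftQ-split : ∀ D s {u v w} → (∀ r → u r ≡ v r + shiftQ s w r) →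
               ∀ M → shiftQ D u M ≡ shiftQ D v M + shiftQ (D ℕ.+ s) w M
shiftQ-split D s {u} {v} {w} u≡v+w M with D ≤? M
... | no D≰M = sym (trans (+-identityˡ _)
                          (shiftQ-below w (λ D+s≤M → D≰M (ℕP.≤-trans (ℕP.m≤m+n D s) D+s≤M))))
... | yes D≤M with r , refl ← ℕP.m≤n⇒∃[o]m+o≡n D≤M rewrite ℕP.m+n∸m≡n D r =
  trans (u≡v+w r) (cong₂ _+_ (refl {x = v r}) (sym (shiftQ-offset D s w r)))

conv-shiftQ : ∀ k F u b → conv F (shiftQ k u) b ≡ shiftQ k (conv F u) b
conv-shiftQ k F u b with k ≤? b
... | no k≰b = sumTo-zero b (λ j _ → trans (cong (F j *_) (shiftQ-below u (k≰b ∘ k≤b∸j⇒k≤b j)))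
                                           (*-zeroʳ (F j)))
  where
  k≤b∸j⇒k≤b : ∀ j → k ℕ.≤ b ∸ j → k ℕ.≤ b
  k≤b∸j⇒k≤b j k≤b∸j = ℕP.≤-trans k≤b∸j (ℕP.m∸n≤m b j)
... | yes k≤b with c , refl ← ℕP.m≤n⇒∃[o]m+o≡n k≤b = begin
  sumTo (k ℕ.+ c) (λ j → F j * shiftQ k u (k ℕ.+ c ∸ j))
    ≡⟨ sumTo-tail c k _ (λ j c<j j≤k+c →
         trans (cong (F j *_) (shiftQ-below u (k≰ j c<j j≤k+c))) (*-zeroʳ (F j))) ⟩
  sumTo c (λ j → F j * shiftQ k u (k ℕ.+ c ∸ j))
    ≡⟨ sumTo-cong c (λ j j≤c → cong (F j *_)
         (trans (cong (shiftQ k u) (ℕP.+-∸-assoc k j≤c)) (shiftQ-at k u (c ∸ j)))) ⟩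
  conv F u c
    ≡⟨ cong (conv F u) (ℕP.m+n∸m≡n k c) ⟨
  conv F u (k ℕ.+ c ∸ k) ∎
  where
  k≰ : ∀ j → c ℕ.< j → j ℕ.≤ k ℕ.+ c → ¬ k ℕ.≤ k ℕ.+ c ∸ j
  k≰ j c<j j≤k+c k≤ = ℕP.<⇒≱ c<j (ℕP.+-cancelˡ-≤ k j c (ℕP.m≤o∸n⇒m+n≤o k j≤k+c k≤))

sumTo-shiftQ : ∀ a k (U : ℕ → ℕ → ℤ) b →
               sumTo a (λ i → shiftQ k (U i) b) ≡ shiftQ k (λ b′ → sumTo a (λ i → U i b′)) b
sumTo-shiftQ a k U b with k ≤? b
... | yes _ = refl
... | no  _ = sumTo-zero a (λ _ _ → refl)

_-ₚ_ : PS → PS → PS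
(f -ₚ g) a b = f a b - g a b

shiftZQ : ℕ → PS → PS
shiftZQ k h zero    b = + 0
shiftZQ k h (suc a) b = shiftQ k (h a) b

shiftZQ-cong : ∀ k {g h} → g ≈ₚ h → shiftZQ k g ≈ₚ shiftZQ k h
shiftZQ-cong k g≈h zero    b = refl
shiftZQ-cong k g≈h (suc a) b = shiftQ-cong k (g≈h a) b

oneₚ-off : ∀ a b → ¬ (a ≡ 0 × b ≡ 0) → oneₚ a b ≡ + 0
oneₚ-off zero    zero    ≢00 = ⊥-elim (≢00 (refl , refl))
oneₚ-off zero    (suc _) _   = refl
oneₚ-off (suc _) _       _   = refl

∸≢0 : ∀ {i a} → i ℕ.≤ a → i ≢ a → a ∸ i ≢ 0
∸≢0 i≤a i≢a a∸i≡0 = i≢a (ℕP.≤-antisym i≤a (ℕP.m∸n≡0⇒m≤n a∸i≡0))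

*ₚ-congˡ : ∀ f {g g′ : PS} → g ≈ₚ g′ → (f *ₚ g) ≈ₚ (f *ₚ g′)
*ₚ-congˡ f g≈g′ a b =
  sumTo-cong a (λ i _ → sumTo-cong b (λ j _ → cong (f i j *_) (g≈g′ (a ∸ i) (b ∸ j))))

*ₚ-congʳ : ∀ {f f′ : PS} g → f ≈ₚ f′ → (f *ₚ g) ≈ₚ (f′ *ₚ g)
*ₚ-congʳ g f≈f′ a b =
  sumTo-cong a (λ i _ → sumTo-cong b (λ j _ → cong (_* g (a ∸ i) (b ∸ j)) (f≈f′ i j)))

*ₚ-comm : ∀ f g → (f *ₚ g) ≈ₚ (g *ₚ f)
*ₚ-comm f g a b =
  trans (sumTo-reverse a _) (sumTo-cong a λ i i≤a →
  trans (sumTo-reverse b _) (sumTo-cong b λ j j≤b → begin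
    f (a ∸ i) (b ∸ j) * g (a ∸ (a ∸ i)) (b ∸ (b ∸ j))
      ≡⟨ cong₂ (λ x y → f (a ∸ i) (b ∸ j) * g x y) (ℕP.m∸[m∸n]≡n i≤a) (ℕP.m∸[m∸n]≡n j≤b) ⟩
    f (a ∸ i) (b ∸ j) * g i j
      ≡⟨ ℤP.*-comm (f (a ∸ i) (b ∸ j)) (g i j) ⟩
    g i j * f (a ∸ i) (b ∸ j) ∎))

*ₚ-identityʳ : ∀ f → (f *ₚ oneₚ) ≈ₚ f
*ₚ-identityʳ f a b = begin
  (f *ₚ oneₚ) a b
    ≡⟨ sumTo-single a a ≤-refl (λ i i≤a i≢a → sumTo-zero b (λ j _ →
         trans (cong (f i j *_) (oneₚ-off (a ∸ i) (b ∸ j) (∸≢0 i≤a i≢a ∘ proj₁)))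
               (*-zeroʳ (f i j)))) ⟩
  conv (f a) (oneₚ (a ∸ a)) b
    ≡⟨ cong (λ x → conv (f a) (oneₚ x) b) (ℕP.n∸n≡0 a) ⟩
  conv (f a) (oneₚ 0) b
    ≡⟨ sumTo-single b b ≤-refl (λ j j≤b j≢b →
         trans (cong (f a j *_) (oneₚ-off 0 (b ∸ j) (∸≢0 j≤b j≢b ∘ proj₂))) (*-zeroʳ (f a j))) ⟩
  f a b * oneₚ 0 (b ∸ b)
    ≡⟨ cong (λ y → f a b * oneₚ 0 y) (ℕP.n∸n≡0 b) ⟩
  f a b * + 1
    ≡⟨ *-identityʳ (f a b) ⟩
  f a b ∎

*ₚ-distribˡ-ₚ : ∀ f g h → (f *ₚ (g -ₚ h)) ≈ₚ ((f *ₚ g) -ₚ (f *ₚ h))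
*ₚ-distribˡ-ₚ f g h a b = begin
  sumTo a (λ i → sumTo b (λ j → f i j * (g (a ∸ i) (b ∸ j) - h (a ∸ i) (b ∸ j))))
    ≡⟨ sumTo-cong a (λ i _ → trans (sumTo-cong b (λ j _ → distrib (f i j) _ _)) (sumTo-- b _ _)) ⟩
  sumTo a (λ i → conv (f i) (g (a ∸ i)) b - conv (f i) (h (a ∸ i)) b)
    ≡⟨ sumTo-- a _ _ ⟩
  (f *ₚ g) a b - (f *ₚ h) a b ∎
  where
  distrib : ∀ x y z → x * (y - z) ≡ x * y - x * z
  distrib = solve-∀

*ₚ-shiftZQ : ∀ k f g → (f *ₚ shiftZQ k g) ≈ₚ shiftZQ k (f *ₚ g)
*ₚ-shiftZQ k f g zero    b = sumTo-zero b (λ j _ → *-zeroʳ (f 0 j))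
*ₚ-shiftZQ k f g (suc a) b = begin
  sumTo a (λ i → conv (f i) (shiftZQ k g (suc a ∸ i)) b) + conv (f (suc a)) (shiftZQ k g (suc a ∸ suc a)) b
    ≡⟨ cong₂ _+_ (sumTo-cong a λ i i≤a →
                    trans (cong (λ x → conv (f i) (shiftZQ k g x) b) (ℕP.+-∸-assoc 1 i≤a))
                          (conv-shiftQ k (f i) (g (a ∸ i)) b))
                 (cong (λ x → conv (f (suc a)) (shiftZQ k g x) b) (ℕP.n∸n≡0 a)) ⟩
  sumTo a (λ i → shiftQ k (conv (f i) (g (a ∸ i))) b) + conv (f (suc a)) (shiftZQ k g 0) b
    ≡⟨ cong₂ _+_ (sumTo-shiftQ a k (λ i → conv (f i) (g (a ∸ i))) b)
                 (sumTo-zero b (λ j _ → *-zeroʳ (f (suc a) j))) ⟩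
  shiftZQ k (f *ₚ g) (suc a) b + + 0
    ≡⟨ +-identityʳ _ ⟩
  shiftZQ k (f *ₚ g) (suc a) b ∎

oneMinusZQ^≈ : ∀ k → oneMinusZQ^ k ≈ₚ (oneₚ -ₚ shiftZQ k oneₚ)
oneMinusZQ^≈ k zero          zero    = refl
oneMinusZQ^≈ k zero          (suc b) = refl
oneMinusZQ^≈ k (suc zero)    b with b ℕ.≟ k | k ≤? b
... | yes refl | yes _   = sym (trans (+-identityˡ _) (cong (λ x → - oneₚ 0 x) (ℕP.n∸n≡0 b)))
... | yes refl | no  b≰b = ⊥-elim (b≰b ≤-refl)
... | no  b≢k  | yes k≤b = sym (trans (+-identityˡ _) (cong (λ x → - x) (oneₚ-off 0 (b ∸ k) b∸k≢0)))
  where b∸k≢0 = ∸≢0 k≤b (b≢k ∘ sym) ∘ proj₂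
... | no  _    | no  _   = refl
oneMinusZQ^≈ k (suc (suc a)) b with k ≤? b
... | yes _ = refl
... | no  _ = refl

*ₚ-oneMinusZQ^ : ∀ k h → (h *ₚ oneMinusZQ^ k) ≈ₚ (h -ₚ shiftZQ k h)
*ₚ-oneMinusZQ^ k h a b = begin
  (h *ₚ oneMinusZQ^ k) a b                     ≡⟨ *ₚ-congˡ h (oneMinusZQ^≈ k) a b ⟩
  (h *ₚ (oneₚ -ₚ shiftZQ k oneₚ)) a b          ≡⟨ *ₚ-distribˡ-ₚ h oneₚ (shiftZQ k oneₚ) a b ⟩
  (h *ₚ oneₚ) a b - (h *ₚ shiftZQ k oneₚ) a b  ≡⟨ cong₂ _-_ (*ₚ-identityʳ h a b)
                                                            (*ₚ-shiftZQ k h oneₚ a b) ⟩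
  h a b - shiftZQ k (h *ₚ oneₚ) a b            ≡⟨ cong₂ _-_ (refl {x = h a b})
                                                            (shiftZQ-cong k (*ₚ-identityʳ h) a b) ⟩
  h a b - shiftZQ k h a b                      ∎

*ₚ-assoc-oneMinusZQ^ : ∀ k f g → (f *ₚ (g *ₚ oneMinusZQ^ k)) ≈ₚ ((f *ₚ g) *ₚ oneMinusZQ^ k)
*ₚ-assoc-oneMinusZQ^ k f g a b = begin
  (f *ₚ (g *ₚ oneMinusZQ^ k)) a b         ≡⟨ *ₚ-congˡ f (*ₚ-oneMinusZQ^ k g) a b ⟩
  (f *ₚ (g -ₚ shiftZQ k g)) a b           ≡⟨ *ₚ-distribˡ-ₚ f g (shiftZQ k g) a b ⟩
  (f *ₚ g) a b - (f *ₚ shiftZQ k g) a b   ≡⟨ cong₂ _-_ (refl {x = (f *ₚ g) a b})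
                                                       (*ₚ-shiftZQ k f g a b) ⟩
  (f *ₚ g) a b - shiftZQ k (f *ₚ g) a b   ≡⟨ *ₚ-oneMinusZQ^ k (f *ₚ g) a b ⟨
  ((f *ₚ g) *ₚ oneMinusZQ^ k) a b         ∎

-- The coefficient of f *ₚ P at (a, b) is f a b plus a combination of the coefficients of f at
-- lexicographically smaller positions, so f is recovered from f *ₚ P by induction.
module _ {P : PS} (P₀₀≡1 : P 0 0 ≡ + 1) where

  private
    rowsBelow colsBelow earlier : PS → ℕ → ℕ → ℤ
    rowsBelow h a b = sumBelow a (λ i → conv (h i) (P (a ∸ i)) b)
    colsBelow h a b = sumBelow b (λ j → h a j * P (a ∸ a) (b ∸ j))
    earlier   h a b = rowsBelow h a b + colsBelow h a b

    *ₚ≡earlier+last : ∀ h a b → (h *ₚ P) a b ≡ earlier h a b + h a b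
    *ₚ≡earlier+last h a b = begin
      (h *ₚ P) a b
        ≡⟨ sumTo≡sumBelow+last a _ ⟩
      rowsBelow h a b + conv (h a) (P (a ∸ a)) b
        ≡⟨ cong₂ _+_ (refl {x = rowsBelow h a b}) (sumTo≡sumBelow+last b _) ⟩
      rowsBelow h a b + (colsBelow h a b + h a b * P (a ∸ a) (b ∸ b))
        ≡⟨ +-assoc (rowsBelow h a b) (colsBelow h a b) _ ⟨
      earlier h a b + h a b * P (a ∸ a) (b ∸ b)
        ≡⟨ cong (λ x → earlier h a b + h a b * x)
                (trans (cong₂ P (ℕP.n∸n≡0 a) (ℕP.n∸n≡0 b)) P₀₀≡1) ⟩
      earlier h a b + h a b * + 1
        ≡⟨ cong₂ _+_ (refl {x = earlier h a b}) (*-identityʳ (h a b)) ⟩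
      earlier h a b + h a b ∎

  *ₚ-cancelʳ : ∀ {f g} → (f *ₚ P) ≈ₚ (g *ₚ P) → f ≈ₚ g
  *ₚ-cancelʳ {f} {g} fP≈gP a b =
    <-rec (λ a → ∀ b → f a b ≡ g a b)
          (λ a rows → <-rec (λ b → f a b ≡ g a b) (λ b cols → agree a b rows cols))
          a b
    where
    agree : ∀ a b → (∀ {i} → i ℕ.< a → ∀ j → f i j ≡ g i j) →
                    (∀ {j} → j ℕ.< b → f a j ≡ g a j) → f a b ≡ g a b
    agree a b rows cols = ∙-cancelˡ (earlier g a b) (f a b) (g a b) (begin
      earlier g a b + f a b ≡⟨ cong (_+ f a b) earlier≡ ⟨
      earlier f a b + f a b ≡⟨ *ₚ≡earlier+last f a b ⟨
      (f *ₚ P) a b          ≡⟨ fP≈gP a b ⟩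
      (g *ₚ P) a b          ≡⟨ *ₚ≡earlier+last g a b ⟩
      earlier g a b + g a b ∎)
      where
      earlier≡ : earlier f a b ≡ earlier g a b
      earlier≡ = cong₂ _+_
        (sumBelow-cong a (λ i i<a → sumTo-cong b (λ j _ → cong (_* P (a ∸ i) (b ∸ j)) (rows i<a j))))
        (sumBelow-cong b (λ j j<b → cong (_* P (a ∸ a) (b ∸ j)) (cols j<b)))

-- The series 1/(zq;q)_n

-- Defined through 1/(zq;q)_(n+1) = 1/(zq;q)_n + z q^(n+1)/(zq;q)_(n+1).
invPoch : ℕ → PS
invPoch zero              = oneₚ
invPoch (suc n) zero    b = invPoch n zero b
invPoch (suc n) (suc a) b with suc n ≤? b
... | yes _ = invPoch n (suc a) b + invPoch (suc n) a (b ∸ suc n)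
... | no  _ = invPoch n (suc a) b

invPoch-suc : ∀ n a b → invPoch (suc n) a b ≡ invPoch n a b + shiftZQ (suc n) (invPoch (suc n)) a b
invPoch-suc n zero    b = sym (+-identityʳ _)
invPoch-suc n (suc a) b with suc n ≤? b
... | yes _ = refl
... | no  _ = sym (+-identityʳ _)

invPoch-*-oneMinusZQ^ : ∀ n → (invPoch (suc n) *ₚ oneMinusZQ^ (suc n)) ≈ₚ invPoch n
invPoch-*-oneMinusZQ^ n a b = begin
  (invPoch (suc n) *ₚ oneMinusZQ^ (suc n)) a b ≡⟨ *ₚ-oneMinusZQ^ (suc n) (invPoch (suc n)) a b ⟩
  invPoch (suc n) a b - S                      ≡⟨ cong (_- S) (invPoch-suc n a b) ⟩
  invPoch n a b + S - S                        ≡⟨ x+y-y≡x (invPoch n a b) S ⟩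
  invPoch n a b                                ∎
  where
  S = shiftZQ (suc n) (invPoch (suc n)) a b
  x+y-y≡x : ∀ x y → x + y - y ≡ x
  x+y-y≡x = solve-∀

poch-00 : ∀ n → poch n 0 0 ≡ + 1
poch-00 zero    = refl
poch-00 (suc n) = trans (*-identityʳ (poch n 0 0)) (poch-00 n)

invPoch-*-poch : ∀ n → (invPoch n *ₚ poch n) ≈ₚ oneₚ
invPoch-*-poch zero        = *ₚ-identityʳ oneₚ
invPoch-*-poch (suc n) a b = begin
  (C′ *ₚ (poch n *ₚ L)) a b  ≡⟨ *ₚ-assoc-oneMinusZQ^ (suc n) C′ (poch n) a b ⟩
  ((C′ *ₚ poch n) *ₚ L) a b  ≡⟨ *ₚ-congʳ L (*ₚ-comm C′ (poch n)) a b ⟩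
  ((poch n *ₚ C′) *ₚ L) a b  ≡⟨ *ₚ-assoc-oneMinusZQ^ (suc n) (poch n) C′ a b ⟨
  (poch n *ₚ (C′ *ₚ L)) a b  ≡⟨ *ₚ-congˡ (poch n) (invPoch-*-oneMinusZQ^ n) a b ⟩
  (poch n *ₚ invPoch n) a b  ≡⟨ *ₚ-comm (poch n) (invPoch n) a b ⟩
  (invPoch n *ₚ poch n) a b  ≡⟨ invPoch-*-poch n a b ⟩
  oneₚ a b                   ∎
  where
  C′ = invPoch (suc n)
  L  = oneMinusZQ^ (suc n)

invPoch-unique : ∀ n {I} → (I *ₚ poch n) ≈ₚ oneₚ → I ≈ₚ invPoch n
invPoch-unique n I*poch≈1 =
  *ₚ-cancelʳ {poch n} (poch-00 n) (λ a b → trans (I*poch≈1 a b) (sym (invPoch-*-poch n a b)))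

coeffℤ : PS → ℤ → ℕ → ℤ
coeffℤ f (+ a)    = f a
coeffℤ f -[1+ _ ] = λ _ → + 0

coeffℤ-cong : ∀ {f g} → f ≈ₚ g → ∀ x r → coeffℤ f x r ≡ coeffℤ g x r
coeffℤ-cong f≈g (+ a)    r = f≈g a r
coeffℤ-cong f≈g -[1+ _ ] r = refl

coeffℤ-oneₚ-off : ∀ x b → ¬ (x ≡ + 0 × b ≡ 0) → coeffℤ oneₚ x b ≡ + 0
coeffℤ-oneₚ-off (+ a)    b ≢00 = oneₚ-off a b (λ (a≡0 , b≡0) → ≢00 (cong +_ a≡0 , b≡0))
coeffℤ-oneₚ-off -[1+ _ ] b _   = refl

shiftCoeff≡shiftQ : ∀ f e d m N → shiftCoeff f e d m N ≡ shiftQ d (coeffℤ f (m - e)) N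
shiftCoeff≡shiftQ f e d m N with d ≤? N | m - e
... | yes _ | + _      = refl
... | yes _ | -[1+ _ ] = refl
... | no  _ | _        = refl

coeffℤ-invPoch-suc : ∀ n y r → coeffℤ (invPoch (suc n)) y r
                             ≡ coeffℤ (invPoch n) y r + shiftQ (suc n) (coeffℤ (invPoch (suc n)) (y - + 1)) r
coeffℤ-invPoch-suc n (+ zero)  r =
  sym (trans (cong₂ _+_ (refl {x = invPoch n 0 r}) (shiftQ-zero (suc n) r)) (+-identityʳ _))
coeffℤ-invPoch-suc n (+ suc k) r = invPoch-suc n (suc k) r
coeffℤ-invPoch-suc n -[1+ _ ]  r = sym (trans (+-identityˡ _) (shiftQ-zero (suc n) r))

termCoeff : ℕ → ℕ → ℤ → ℕ → ℤ
termCoeff ℓ n m M = shiftQ (n ℕ.* n ℕ.+ ℓ ℕ.* n) (coeffℤ (invPoch n) (m - (+ (n ℕ.+ ℓ) - + 1))) M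

termCoeff-beyond : ∀ ℓ n m M → ¬ suc n ℕ.≤ M → termCoeff ℓ (suc n) m M ≡ + 0
termCoeff-beyond ℓ n m M n≰M = shiftQ-below _ (λ d≤M → n≰M (ℕP.≤-trans 1+n≤d d≤M))
  where 1+n≤d = ℕP.≤-trans (ℕP.m≤m*n (suc n) (suc n)) (ℕP.m≤m+n _ (ℓ ℕ.* suc n))

termCoeff-suc-ℓ : ∀ ℓ n m M → termCoeff (suc ℓ) n m (n ℕ.+ M) ≡ termCoeff ℓ n (m - + 1) M
termCoeff-suc-ℓ ℓ n m M = begin
  termCoeff (suc ℓ) n m (n ℕ.+ M)
    ≡⟨ cong₂ (λ d x → shiftQ d (coeffℤ (invPoch n) x) (n ℕ.+ M)) degree exponent ⟩
  shiftQ (n ℕ.+ (n ℕ.* n ℕ.+ ℓ ℕ.* n))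
         (coeffℤ (invPoch n) ((m - + 1) - (+ (n ℕ.+ ℓ) - + 1))) (n ℕ.+ M)
    ≡⟨ shiftQ-offset n _ _ M ⟩
  termCoeff ℓ n (m - + 1) M ∎
  where
  degree : n ℕ.* n ℕ.+ suc ℓ ℕ.* n ≡ n ℕ.+ (n ℕ.* n ℕ.+ ℓ ℕ.* n)
  degree = lemma n ℓ
    where lemma : ∀ n l → n ℕ.* n ℕ.+ (1 ℕ.+ l) ℕ.* n ≡ n ℕ.+ (n ℕ.* n ℕ.+ l ℕ.* n)
          lemma = ℕSolver.solve-∀
  exponent : m - (+ (n ℕ.+ suc ℓ) - + 1) ≡ (m - + 1) - (+ (n ℕ.+ ℓ) - + 1)
  exponent rewrite ℤP.pos-+ n (suc ℓ) | ℤP.pos-+ n ℓ | ℤP.pos-+ 1 ℓ = lemma m (+ n) (+ ℓ)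
    where lemma : ∀ m n l → m - (n + (+ 1 + l) - + 1) ≡ (m - + 1) - (n + l - + 1)
          lemma = solve-∀

termCoeff-zero-ℓ : ∀ n m M →
  termCoeff 0 (suc n) m (suc n ℕ.+ M) ≡ termCoeff 1 n m M + termCoeff 0 (suc n) (m - + 1) M
termCoeff-zero-ℓ n m M = begin
  termCoeff 0 (suc n) m (suc n ℕ.+ M)
    ≡⟨ cong₂ (λ d x → shiftQ d (coeffℤ C′ x) (suc n ℕ.+ M)) degree₀ exponent₀ ⟩
  shiftQ (suc n ℕ.+ D) (coeffℤ C′ y) (suc n ℕ.+ M)
    ≡⟨ shiftQ-offset (suc n) D _ M ⟩
  shiftQ D (coeffℤ C′ y) M
    ≡⟨ shiftQ-split D (suc n) (coeffℤ-invPoch-suc n y) M ⟩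
  termCoeff 1 n m M + shiftQ (D ℕ.+ suc n) (coeffℤ C′ (y - + 1)) M
    ≡⟨ cong₂ _+_ (refl {x = termCoeff 1 n m M})
                 (cong₂ (λ d x → shiftQ d (coeffℤ C′ x) M) degree₁ exponent₁) ⟨
  termCoeff 1 n m M + termCoeff 0 (suc n) (m - + 1) M ∎
  where
  C′ = invPoch (suc n)
  D  = n ℕ.* n ℕ.+ 1 ℕ.* n
  y  = m - (+ (n ℕ.+ 1) - + 1)
  1+n+0≡n+1 : suc n ℕ.+ 0 ≡ n ℕ.+ 1
  1+n+0≡n+1 = trans (ℕP.+-identityʳ (suc n)) (ℕP.+-comm 1 n)
  degree₀ : suc n ℕ.* suc n ℕ.+ 0 ℕ.* suc n ≡ suc n ℕ.+ D
  degree₀ = lemma n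
    where lemma : ∀ n → (1 ℕ.+ n) ℕ.* (1 ℕ.+ n) ℕ.+ 0 ℕ.* (1 ℕ.+ n)
                      ≡ (1 ℕ.+ n) ℕ.+ (n ℕ.* n ℕ.+ 1 ℕ.* n)
          lemma = ℕSolver.solve-∀
  degree₁ : suc n ℕ.* suc n ℕ.+ 0 ℕ.* suc n ≡ D ℕ.+ suc n
  degree₁ = trans degree₀ (ℕP.+-comm (suc n) D)
  exponent₀ : m - (+ (suc n ℕ.+ 0) - + 1) ≡ y
  exponent₀ = cong (λ k → m - (+ k - + 1)) 1+n+0≡n+1
  exponent₁ : (m - + 1) - (+ (suc n ℕ.+ 0) - + 1) ≡ y - + 1
  exponent₁ = trans (cong (λ k → (m - + 1) - (+ k - + 1)) 1+n+0≡n+1) (lemma m (+ (n ℕ.+ 1) - + 1))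
    where lemma : ∀ m k → (m - + 1) - k ≡ (m - k) - + 1
          lemma = solve-∀

-- Counting Rogers–Ramanujan partitions

count : ∀ {A : Set} {P : A → Set} → Decidable P → List A → ℕ
count P? xs = length (filter P? xs)

indicator : ∀ {Q : Set} → Dec Q → ℤ
indicator d = if does d then + 1 else + 0

module _ {A : Set} where

  count-++ : ∀ {P : A → Set} (P? : Decidable P) xs ys →
             count P? (xs ++ ys) ≡ count P? xs ℕ.+ count P? ys
  count-++ P? xs ys = trans (cong length (LP.filter-++ P? xs ys)) (LP.length-++ (filter P? xs))

  count-map : ∀ {B : Set} {P : B → Set} (P? : Decidable P) (f : A → B) xs →
              count P? (map f xs) ≡ count (P? ∘ f) xs
  count-map P? f []       = refl
  count-map P? f (x ∷ xs) with does (P? (f x))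
  ... | true  = cong suc (count-map P? f xs)
  ... | false = count-map P? f xs

  count-⇔ : ∀ {P Q : A → Set} (P? : Decidable P) (Q? : Decidable Q) → (∀ x → P x ⇔ Q x) →
            ∀ xs → count P? xs ≡ count Q? xs
  count-⇔ P? Q? P⇔Q xs = cong length (LP.filter-≐ P? Q? (to , from) xs)
    where
    to   = λ {x} → Equivalence.to (P⇔Q x)
    from = λ {x} → Equivalence.from (P⇔Q x)

  count-none : ∀ {P : A → Set} (P? : Decidable P) → (∀ x → ¬ P x) → ∀ xs → count P? xs ≡ 0
  count-none P? ¬P xs = cong length (LP.filter-none P? (All.universal ¬P xs))

  count-∷ : ∀ {P : A → Set} (P? : Decidable P) x xs →
            + count P? (x ∷ xs) ≡ indicator (P? x) + + count P? xs
  count-∷ P? x xs with does (P? x)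
  ... | true  = refl
  ... | false = refl

  count-fibres : ∀ {P : A → Set} (P? : Decidable P) (f : A → ℕ) N → (∀ x → P x → f x ℕ.≤ N) →
                 ∀ xs → + count P? xs ≡ sumTo N (λ n → + count (λ x → P? x ×-dec (f x ℕ.≟ n)) xs)
  count-fibres {P} P? f N bound []       = sym (sumTo-zero N (λ _ _ → refl))
  count-fibres {P} P? f N bound (x ∷ xs) = begin
    + count P? (x ∷ xs)
      ≡⟨ count-∷ P? x xs ⟩
    indicator (P? x) + + count P? xs
      ≡⟨ cong₂ _+_ (fibres (P? x)) (count-fibres P? f N bound xs) ⟩
    sumTo N (λ n → indicator (Q? n x)) + sumTo N (λ n → + count (Q? n) xs)
      ≡⟨ sumTo-+ N _ _ ⟨
    sumTo N (λ n → indicator (Q? n x) + + count (Q? n) xs)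
      ≡⟨ sumTo-cong N (λ n _ → count-∷ (Q? n) x xs) ⟨
    sumTo N (λ n → + count (Q? n) (x ∷ xs)) ∎
    where
    Q? : ∀ n → Decidable (λ y → P y × f y ≡ n)
    Q? n y = P? y ×-dec (f y ℕ.≟ n)
    indicator-yes : ∀ {Q : Set} (d : Dec Q) → Q → indicator d ≡ + 1
    indicator-yes (yes _) _ = refl
    indicator-yes (no ¬q) q = ⊥-elim (¬q q)
    indicator-no : ∀ {Q : Set} (d : Dec Q) → ¬ Q → indicator d ≡ + 0
    indicator-no (yes q) ¬q = ⊥-elim (¬q q)
    indicator-no (no _)  _  = refl
    fibres : (d : Dec (P x)) → indicator d ≡ sumTo N (λ n → indicator (d ×-dec (f x ℕ.≟ n)))
    fibres (yes p) = sym (trans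
      (sumTo-single N (f x) (bound x p) (λ n _ n≢fx →
         indicator-no (yes p ×-dec (f x ℕ.≟ n)) (λ (_ , fx≡n) → n≢fx (sym fx≡n))))
      (indicator-yes (yes p ×-dec (f x ℕ.≟ f x)) (p , refl)))
    fibres (no ¬p) = sym (sumTo-zero N (λ n _ → indicator-no (no ¬p ×-dec (f x ℕ.≟ n)) (¬p ∘ proj₁)))

map-suc-positive : ∀ xs → All (0 ℕ.<_) (map suc xs)
map-suc-positive xs = AllP.map⁺ (All.universal (λ _ → s≤s z≤n) xs)

parts-positive : ∀ {K} (v : Vec Bool K) → All (0 ℕ.<_) (parts v)
parts-positive []          = []
parts-positive (true  ∷ v) = s≤s z≤n ∷ map-suc-positive (parts v)
parts-positive (false ∷ v) = map-suc-positive (parts v)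

length-parts≤ : ∀ {K} (v : Vec Bool K) → length (parts v) ℕ.≤ K
length-parts≤ []          = z≤n
length-parts≤ (true  ∷ v) = s≤s (subst (ℕ._≤ _) (sym (LP.length-map suc (parts v))) (length-parts≤ v))
length-parts≤ (false ∷ v) =
  m≤n⇒m≤1+n (subst (ℕ._≤ _) (sym (LP.length-map suc (parts v))) (length-parts≤ v))

length≤sum : ∀ {xs} → All (0 ℕ.<_) xs → length xs ℕ.≤ sum xs
length≤sum []         = z≤n
length≤sum (0<x ∷ ps) = ℕP.+-mono-≤ 0<x (length≤sum ps)

sum-map-suc : ∀ xs → sum (map suc xs) ≡ length xs ℕ.+ sum xs
sum-map-suc []       = refl
sum-map-suc (x ∷ xs) =
  cong suc (trans (cong (x ℕ.+_) (sum-map-suc xs)) (ℕCS.x∙yz≈y∙xz x (length xs) (sum xs)))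

max-map-suc : ∀ y ys → foldr _⊔_ 0 (map suc (y ∷ ys)) ≡ suc (foldr _⊔_ 0 (y ∷ ys))
max-map-suc y []         = cong suc (sym (ℕP.⊔-identityʳ y))
max-map-suc y (y′ ∷ ys) = cong (suc y ⊔_) (max-map-suc y′ ys)

rank-map-suc : ∀ ℓ ℓ′ y ys → rank ℓ (map suc (y ∷ ys)) ≡ rank ℓ′ (y ∷ ys) + + 1
rank-map-suc ℓ ℓ′ y ys
  rewrite max-map-suc y ys | LP.length-map suc ys | ℤP.pos-+ 1 (foldr _⊔_ 0 (y ∷ ys)) =
  lemma (+ foldr _⊔_ 0 (y ∷ ys)) (+ suc (length ys))
  where lemma : ∀ a b → (+ 1 + a) - b ≡ (a - b) + + 1
        lemma = solve-∀

rank-1∷map-suc : ∀ ys → rank 0 (1 ∷ map suc ys) ≡ rank 1 ys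
rank-1∷map-suc []       = refl
rank-1∷map-suc (y ∷ ys)
  rewrite max-map-suc y ys | LP.length-map suc ys
        | ℤP.pos-+ 1 (foldr _⊔_ 0 (y ∷ ys)) | ℤP.pos-+ 1 (suc (length ys)) =
  lemma (+ foldr _⊔_ 0 (y ∷ ys)) (+ suc (length ys))
  where lemma : ∀ a b → (+ 1 + a) - (+ 1 + b) ≡ a - b
        lemma = solve-∀

Gap2-map-suc⁺ : ∀ xs → Gap2 xs → Gap2 (map suc xs)
Gap2-map-suc⁺ []           _           = _
Gap2-map-suc⁺ (x ∷ [])     _           = _
Gap2-map-suc⁺ (x ∷ y ∷ xs) (x+2≤y , g) = s≤s x+2≤y , Gap2-map-suc⁺ (y ∷ xs) g

Gap2-map-suc⁻ : ∀ xs → Gap2 (map suc xs) → Gap2 xs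
Gap2-map-suc⁻ []           _               = _
Gap2-map-suc⁻ (x ∷ [])     _               = _
Gap2-map-suc⁻ (x ∷ y ∷ xs) (s≤s x+2≤y , g) = x+2≤y , Gap2-map-suc⁻ (y ∷ xs) g

Gap2⇒head< : ∀ x xs → Gap2 (x ∷ xs) → All (x ℕ.<_) xs
Gap2⇒head< x []       _           = []
Gap2⇒head< x (y ∷ xs) (x+2≤y , g) = x<y ∷ All.map (ℕP.<-trans x<y) (Gap2⇒head< y xs g)
  where x<y = ℕP.m+n≤o⇒m≤o (suc x) (subst (ℕ._≤ y) (ℕP.+-suc x 1) x+2≤y)

Gap2-1∷map-suc⁺ : ∀ ys → All (1 ℕ.<_) ys → Gap2 ys → Gap2 (1 ∷ map suc ys)
Gap2-1∷map-suc⁺ []       _         _ = _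
Gap2-1∷map-suc⁺ (y ∷ ys) (1<y ∷ _) g = s≤s 1<y , Gap2-map-suc⁺ (y ∷ ys) g

Gap2-1∷map-suc⁻ : ∀ ys → Gap2 (1 ∷ map suc ys) → All (1 ℕ.<_) ys × Gap2 ys
Gap2-1∷map-suc⁻ []       _             = [] , _
Gap2-1∷map-suc⁻ (y ∷ ys) (s≤s 1<y , g) = 1<y ∷ All.map (ℕP.<-trans 1<y) (Gap2⇒head< y ys gap) , gap
  where gap = Gap2-map-suc⁻ (y ∷ ys) g

All-<-map-suc⁺ : ∀ ℓ ys → All (ℓ ∸ 1 ℕ.<_) ys → All (ℓ ℕ.<_) (map suc ys)
All-<-map-suc⁺ zero    ys _  = map-suc-positive ys
All-<-map-suc⁺ (suc ℓ) ys ℓ< = AllP.map⁺ (All.map s≤s ℓ<)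

All-<-map-suc⁻ : ∀ ℓ ys → All (0 ℕ.<_) ys → All (ℓ ℕ.<_) (map suc ys) → All (ℓ ∸ 1 ℕ.<_) ys
All-<-map-suc⁻ zero    ys pos _  = pos
All-<-map-suc⁻ (suc ℓ) ys _   ℓ< = All.map ℕ.s≤s⁻¹ (AllP.map⁻ ℓ<)

-- Nested like `isRR? ℓ N v ×-dec (rank ℓ (parts v) ≟ m)`, so that the predicate defining R ℓ m N,
-- refined by the number of parts, is literally `isRRPartition?` on `parts v`.
IsRRPartition : ℕ → ℕ → ℤ → ℕ → List ℕ → Set
IsRRPartition ℓ n m M xs =
  (((sum xs ≡ M) × (All (ℓ ℕ.<_) xs × Gap2 xs)) × (rank ℓ xs ≡ m)) × (length xs ≡ n)

isRRPartition? : ∀ ℓ n m M xs → Dec (IsRRPartition ℓ n m M xs)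
isRRPartition? ℓ n m M xs =
  (((sum xs ℕ.≟ M) ×-dec (all? (ℓ <?_) xs ×-dec gap2? xs)) ×-dec (rank ℓ xs ℤ.≟ m))
  ×-dec (length xs ℕ.≟ n)

sum-map-suc⇔ : ∀ ys {k M} → length ys ≡ k → (sum (map suc ys) ≡ k ℕ.+ M) ⇔ (sum ys ≡ M)
sum-map-suc⇔ ys refl = mk⇔ (λ Σ≡ → ℕP.+-cancelˡ-≡ (length ys) _ _ (trans (sym (sum-map-suc ys)) Σ≡))
                           (λ Σ≡ → trans (sum-map-suc ys) (cong (length ys ℕ.+_) Σ≡))

+1≡⇔≡-1 : ∀ {x m} → (x + + 1 ≡ m) ⇔ (x ≡ m - + 1)
+1≡⇔≡-1 {x} {m} = mk⇔ (λ x+1≡m → trans (lemma₁ x) (cong (_- + 1) x+1≡m))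
                        (λ x≡m-1 → trans (cong (_+ + 1) x≡m-1) (lemma₂ m))
  where
  lemma₁ : ∀ x → x ≡ (x + + 1) - + 1
  lemma₁ = solve-∀
  lemma₂ : ∀ m → (m - + 1) + + 1 ≡ m
  lemma₂ = solve-∀

drop-column : ∀ ℓ n m M ys → All (0 ℕ.<_) ys →
  IsRRPartition ℓ (suc n) m (suc n ℕ.+ M) (map suc ys) ⇔ IsRRPartition (ℓ ∸ 1) (suc n) (m - + 1) M ys
drop-column ℓ n m M []             _   = mk⇔ (λ { (_ , ()) }) (λ { (_ , ()) })
drop-column ℓ n m M ys@(y ∷ ys′) pos = mk⇔ to from
  where
  to : IsRRPartition ℓ (suc n) m (suc n ℕ.+ M) (map suc ys) → IsRRPartition (ℓ ∸ 1) (suc n) (m - + 1) M ys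
  to (((Σ≡ , ℓ< , gap) , rk) , len) =
    ((Equivalence.to (sum-map-suc⇔ ys len′) Σ≡ , All-<-map-suc⁻ ℓ ys pos ℓ< , Gap2-map-suc⁻ ys gap) ,
     Equivalence.to +1≡⇔≡-1 (trans (sym (rank-map-suc ℓ (ℓ ∸ 1) y ys′)) rk)) , len′
    where len′ = trans (sym (LP.length-map suc ys)) len
  from : IsRRPartition (ℓ ∸ 1) (suc n) (m - + 1) M ys → IsRRPartition ℓ (suc n) m (suc n ℕ.+ M) (map suc ys)
  from (((Σ≡ , ℓ< , gap) , rk) , len) =
    ((Equivalence.from (sum-map-suc⇔ ys len) Σ≡ , All-<-map-suc⁺ ℓ ys ℓ< , Gap2-map-suc⁺ ys gap) ,
     trans (rank-map-suc ℓ (ℓ ∸ 1) y ys′) (Equivalence.from +1≡⇔≡-1 rk)) ,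
    trans (LP.length-map suc ys) len

remove-part-1 : ∀ n m M ys →
  IsRRPartition 0 (suc n) m (suc n ℕ.+ M) (1 ∷ map suc ys) ⇔ IsRRPartition 1 n m M ys
remove-part-1 n m M ys = mk⇔ to from
  where
  to : IsRRPartition 0 (suc n) m (suc n ℕ.+ M) (1 ∷ map suc ys) → IsRRPartition 1 n m M ys
  to (((Σ≡ , _ , gap) , rk) , len) =
    ((Equivalence.to (sum-map-suc⇔ ys len′) (ℕP.suc-injective Σ≡) , Gap2-1∷map-suc⁻ ys gap) ,
     trans (sym (rank-1∷map-suc ys)) rk) , len′
    where len′ = trans (sym (LP.length-map suc ys)) (ℕP.suc-injective len)
  from : IsRRPartition 1 n m M ys → IsRRPartition 0 (suc n) m (suc n ℕ.+ M) (1 ∷ map suc ys)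
  from (((Σ≡ , 1< , gap) , rk) , len) =
    ((cong suc (Equivalence.from (sum-map-suc⇔ ys len) Σ≡) ,
      s≤s z≤n ∷ map-suc-positive ys , Gap2-1∷map-suc⁺ ys 1< gap) ,
     trans (rank-1∷map-suc ys) rk) , cong suc (trans (LP.length-map suc ys) len)

part-1-excluded : ∀ ℓ n m M ys → ¬ IsRRPartition (suc ℓ) n m M (1 ∷ ys)
part-1-excluded ℓ n m M ys (((_ , (s≤s () ∷ _) , _) , _) , _)

no-parts-map-suc : ∀ ℓ m M ys → IsRRPartition ℓ 0 m M (map suc ys) ⇔ IsRRPartition ℓ 0 m M ys
no-parts-map-suc ℓ m M []      = mk⇔ (λ rr → rr) (λ rr → rr)
no-parts-map-suc ℓ m M (_ ∷ _) = mk⇔ (λ { (_ , ()) }) (λ { (_ , ()) })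

too-few-parts : ∀ ℓ n m M {xs} → All (0 ℕ.<_) xs → ¬ n ℕ.≤ M → ¬ IsRRPartition ℓ n m M xs
too-few-parts ℓ n m M pos n≰M (((Σ≡ , _) , _) , len) = n≰M (subst₂ ℕ._≤_ len Σ≡ (length≤sum pos))

#RR : ℕ → ℕ → ℕ → ℤ → ℕ → ℕ
#RR K ℓ n m M = count (λ v → isRRPartition? ℓ n m M (parts v)) (allVecs K)

#RR-suc : ∀ K ℓ n m M →
  #RR (suc K) ℓ n m M ≡ count (λ v → isRRPartition? ℓ n m M (1 ∷ map suc (parts v))) (allVecs K)
                      ℕ.+ count (λ v → isRRPartition? ℓ n m M (map suc (parts v))) (allVecs K)
#RR-suc K ℓ n m M =
  trans (count-++ P? (map (true ∷_) (allVecs K)) (map (false ∷_) (allVecs K)))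
        (cong₂ ℕ._+_ (count-map P? (true ∷_) (allVecs K)) (count-map P? (false ∷_) (allVecs K)))
  where P? = λ (v : Vec Bool (suc K)) → isRRPartition? ℓ n m M (parts v)

#RR-empty : ∀ ℓ m M → + #RR 0 ℓ 0 m M ≡ termCoeff ℓ 0 m M
#RR-empty ℓ m M =
  trans (count≡coeff M) (cong (λ d → shiftQ d (coeffℤ oneₚ (m - (+ ℓ - + 1))) M) (sym (ℕP.*-zeroʳ ℓ)))
  where
  count≡coeff : ∀ M → + #RR 0 ℓ 0 m M ≡ coeffℤ oneₚ (m - (+ ℓ - + 1)) M
  count≡coeff (suc M) = sym (coeffℤ-oneₚ-off (m - (+ ℓ - + 1)) (suc M) (λ ()))
  count≡coeff zero with (+ ℓ - + 1) ℤ.≟ m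
  ... | yes refl = cong (λ x → coeffℤ oneₚ x 0) (sym (ℤP.+-inverseʳ (+ ℓ - + 1)))
  ... | no  ≢m   = sym (coeffℤ-oneₚ-off _ 0 (λ (m-r≡0 , _) → ≢m (sym (ℤP.i-j≡0⇒i≡j m _ m-r≡0))))

#RR-zero-parts : ∀ K ℓ m M → + #RR K ℓ 0 m M ≡ termCoeff ℓ 0 m M
#RR-zero-parts zero    ℓ m M = #RR-empty ℓ m M
#RR-zero-parts (suc K) ℓ m M = trans (cong +_ #RR-suc≡#RR) (#RR-zero-parts K ℓ m M)
  where
  #RR-suc≡#RR : #RR (suc K) ℓ 0 m M ≡ #RR K ℓ 0 m M
  #RR-suc≡#RR = trans (#RR-suc K ℓ 0 m M) (cong₂ ℕ._+_
    (count-none _ (λ { _ (_ , ()) }) (allVecs K))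
    (count-⇔ _ _ (λ v → no-parts-map-suc ℓ m M (parts v)) (allVecs K)))

#RR≡termCoeff : ∀ K ℓ n m M → M ℕ.≤ K → + #RR K ℓ n m M ≡ termCoeff ℓ n m M
#RR-peel : ∀ K ℓ n m M → suc n ℕ.+ M ℕ.≤ K →
           + #RR K ℓ (suc n) m (suc n ℕ.+ M) ≡ termCoeff ℓ (suc n) m (suc n ℕ.+ M)

#RR≡termCoeff K ℓ zero    m M _   = #RR-zero-parts K ℓ m M
#RR≡termCoeff K ℓ (suc n) m M M≤K with suc n ≤? M
... | no  n≰M =
  trans (cong +_ (count-none _ (λ v → too-few-parts ℓ (suc n) m M (parts-positive v) n≰M) (allVecs K)))
        (sym (termCoeff-beyond ℓ n m M n≰M))
... | yes n≤M with M′ , refl ← ℕP.m≤n⇒∃[o]m+o≡n n≤M = #RR-peel K ℓ n m M′ M≤K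

#RR-peel (suc K) ℓ n m M (s≤s n+M≤K) = begin
  + #RR (suc K) ℓ (suc n) m (suc n ℕ.+ M)
    ≡⟨ cong +_ (#RR-suc K ℓ (suc n) m (suc n ℕ.+ M)) ⟩
  + (withPart1 ℓ ℕ.+ count (λ v → isRRPartition? ℓ (suc n) m (suc n ℕ.+ M) (map suc (parts v))) (allVecs K))
    ≡⟨ cong (λ c → + (withPart1 ℓ ℕ.+ c))
            (count-⇔ _ _ (λ v → drop-column ℓ n m M (parts v) (parts-positive v)) (allVecs K)) ⟩
  + (withPart1 ℓ ℕ.+ #RR K (ℓ ∸ 1) (suc n) (m - + 1) M)
    ≡⟨ ℤP.pos-+ (withPart1 ℓ) _ ⟩
  + withPart1 ℓ + + #RR K (ℓ ∸ 1) (suc n) (m - + 1) M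
    ≡⟨ cong₂ _+_ (refl {x = + withPart1 ℓ}) (#RR≡termCoeff K (ℓ ∸ 1) (suc n) (m - + 1) M M≤K) ⟩
  + withPart1 ℓ + termCoeff (ℓ ∸ 1) (suc n) (m - + 1) M
    ≡⟨ by-part-1 ℓ ⟩
  termCoeff ℓ (suc n) m (suc n ℕ.+ M) ∎
  where
  M≤K = ℕP.≤-trans (ℕP.m≤n+m M n) n+M≤K
  withPart1 : ℕ → ℕ
  withPart1 ℓ = count (λ v → isRRPartition? ℓ (suc n) m (suc n ℕ.+ M) (1 ∷ map suc (parts v))) (allVecs K)
  by-part-1 : ∀ ℓ → + withPart1 ℓ + termCoeff (ℓ ∸ 1) (suc n) (m - + 1) M
                  ≡ termCoeff ℓ (suc n) m (suc n ℕ.+ M)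
  by-part-1 zero = begin
    + withPart1 0 + termCoeff 0 (suc n) (m - + 1) M
      ≡⟨ cong (λ c → + c + termCoeff 0 (suc n) (m - + 1) M)
              (count-⇔ _ _ (λ v → remove-part-1 n m M (parts v)) (allVecs K)) ⟩
    + #RR K 1 n m M + termCoeff 0 (suc n) (m - + 1) M
      ≡⟨ cong (_+ termCoeff 0 (suc n) (m - + 1) M) (#RR≡termCoeff K 1 n m M M≤K) ⟩
    termCoeff 1 n m M + termCoeff 0 (suc n) (m - + 1) M
      ≡⟨ termCoeff-zero-ℓ n m M ⟨
    termCoeff 0 (suc n) m (suc n ℕ.+ M) ∎
  by-part-1 (suc ℓ) = begin
    + withPart1 (suc ℓ) + termCoeff ℓ (suc n) (m - + 1) M
      ≡⟨ cong (λ c → + c + termCoeff ℓ (suc n) (m - + 1) M)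
              (count-none _ (λ v → part-1-excluded ℓ (suc n) m _ _) (allVecs K)) ⟩
    + 0 + termCoeff ℓ (suc n) (m - + 1) M
      ≡⟨ +-identityˡ _ ⟩
    termCoeff ℓ (suc n) (m - + 1) M
      ≡⟨ termCoeff-suc-ℓ ℓ (suc n) m M ⟨
    termCoeff (suc ℓ) (suc n) m (suc n ℕ.+ M) ∎

theorem4p1 : (ℓ : ℕ) → (I : ℕ → PS) → (∀ n → (I n *ₚ poch n) ≈ₚ oneₚ)
           → ∀ (m : ℤ) (N : ℕ) → + (R ℓ m N) ≡ rhsCoeff ℓ I m N
theorem4p1 ℓ I I*poch≈1 m N = begin
  + R ℓ m N
    ≡⟨ count-fibres (λ v → isRR? ℓ N v ×-dec (rank ℓ (parts v) ℤ.≟ m)) (λ v → length (parts v)) N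
                    (λ v _ → length-parts≤ v) (allVecs N) ⟩
  sumTo N (λ n → + #RR N ℓ n m N)
    ≡⟨ sumTo-cong N (λ n _ → #RR≡termCoeff N ℓ n m N ≤-refl) ⟩
  sumTo N (λ n → termCoeff ℓ n m N)
    ≡⟨ sumTo-cong N (λ n _ → summand≡termCoeff n) ⟨
  rhsCoeff ℓ I m N ∎
  where
  summand≡termCoeff : ∀ n →
    shiftCoeff (I n) (+ (n ℕ.+ ℓ) - + 1) (n ℕ.* n ℕ.+ ℓ ℕ.* n) m N ≡ termCoeff ℓ n m N
  summand≡termCoeff n =
    trans (shiftCoeff≡shiftQ (I n) (+ (n ℕ.+ ℓ) - + 1) (n ℕ.* n ℕ.+ ℓ ℕ.* n) m N)
          (shiftQ-cong (n ℕ.* n ℕ.+ ℓ ℕ.* n)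
                       (coeffℤ-cong (invPoch-unique n (I*poch≈1 n)) (m - (+ (n ℕ.+ ℓ) - + 1))) N)
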